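{- Let $P$ be a finite poset, $\mathbb{S}$ a skew field containing an infinite field as a subfield, $C$ a central element of $\mathbb{S}$, and let $v_1,\dots,v_k$ be pairwise incomparable elements of $P$. Then for $1\le i\le k$, $$\tau_{v_1}^*\tau_{v_2}^*\cdots\tau_{v_i}^*=\eta_{\{v_1,\dots,v_i\}}\,T_{v_1}T_{v_2}\cdots T_{v_i}\,\eta_{\{v_1,\dots,v_i\}}^{ -1}.$$
   Context: $\mathbb{S}^P$ is the set of labelings $P\to\mathbb{S}$; products denote composition of partial maps, rightmost first; $\overline{x}=x^{ -1}$; the parallel sum of $z_1,\dots,z_m$ is $\sum^{\parallel}_iz_i=\overline{\overline{z_1}+\cdots+\overline{z_m}}$. $\widehat P$ is $P$ with a new minimum $\widehat0$ and maximum $\widehat1$; $x\lessdot y$ means $y$ covers $x$ in $\widehat P$. The noncommutative order toggle $T_v$ changes only the label at $v$: $(T_vf)(v)=\big(\sum_{u\lessdot v}f(u)\big)\overline{f(v)}\big(\sum^{\parallel}_{u\gtrdot v}f(u)\big)$ with $f(\widehat0)=1$, $f(\widehat1)=C$; its inverse is the elggot $E_v$, $(E_vf)(v)=\big(\sum^{\parallel}_{u\gtrdot v}f(u)\big)\overline{f(v)}\big(\sum_{u\lessdot v}f(u)\big)$. For $S\subseteq P$, $\eta_S=T_{x_1}T_{x_2}\cdots T_{x_m}$ where $(x_1,\dots,x_m)$ is a linear extension (listing with $x_a<x_b\Rightarrow a<b$) of $\{x\in P: x<y\text{ for some }y\in S\}$ (identity if this set is empty); $\eta_v=\eta_{\{v\}}$;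 $\tau_v^*=\eta_vT_v\eta_v^{ -1}$. -}

module Defs where

open import Level using (Level; _⊔_) renaming (suc to lsuc)
open import Algebra.Bundles using (Ring)
open import Data.Nat using (ℕ)
open import Data.Fin as Fin using (Fin)
open import Data.Fin.Properties using () renaming (_≟_ to _≟F_)
open import Data.List using (List; []; _∷_; map; filter; foldr; length; lookup)
open import Data.List.Membership.Propositional using (_∈_)
open import Data.List.Relation.Unary.All using (All; []; _∷_; all?)
open import Data.List.Relation.Unary.Unique.Propositional using (Unique)
open import Data.List.Relation.Binary.Pointwise using (Pointwise)
open import Data.Product using (Σ; ∃; _×_; _,_)
open import Data.Product.Relation.Binary.Pointwise.NonDependent using ()
open import Data.Empty using (⊥)
open import Data.Unit using (⊤; tt)
open import Relation.Nullary using (¬_; Dec; yes; no)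
open import Relation.Nullary.Decidable using (_×-dec_; ¬?)
open import Relation.Binary.PropositionalEquality using (_≡_; _≢_)
open import Relation.Binary.Structures using (IsDecPartialOrder)

record SkewField (c ℓ : Level) : Set (lsuc (c ⊔ ℓ)) where
  field
    ring : Ring c ℓ
  open Ring ring public
  Inv : Carrier → Carrier → Set ℓ
  Inv x y = (x * y ≈ 1#) × (y * x ≈ 1#)
  field
    nontrivial : ¬ (1# ≈ 0#)
    inverse    : ∀ x → ¬ (x ≈ 0#) → ∃ λ y → Inv x y

record InfiniteSubfield {c ℓ} (S : SkewField c ℓ) (k : Level)
       : Set (lsuc k ⊔ c ⊔ ℓ) where
  open SkewField S
  field
    K       : Carrier → Set k
    K-resp  : ∀ {x y} → x ≈ y → K x → K y
    K-0     : K 0#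
    K-1     : K 1#
    K-+     : ∀ {x y} → K x → K y → K (x + y)
    K-neg   : ∀ {x} → K x → K (- x)
    K-*     : ∀ {x y} → K x → K y → K (x * y)
    K-inv   : ∀ {x y} → K x → Inv x y → K y
    K-comm  : ∀ {x y} → K x → K y → x * y ≈ y * x
    -- infinitude: an injective sequence of elements of K
    enum     : ℕ → Carrier
    enum-K   : ∀ m → K (enum m)
    enum-inj : ∀ m n → enum m ≈ enum n → m ≡ n

IsCentral : ∀ {c ℓ} (S : SkewField c ℓ) → SkewField.Carrier S → Set (c ⊔ ℓ)
IsCentral S C = ∀ x → C * x ≈ x * C
  where open SkewField S

record FinPoset : Set₁ where
  field
    n     : ℕ
    _≤_   : Fin n → Fin n → Set
    isDecPartialOrder : IsDecPartialOrder _≡_ _≤_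
  open IsDecPartialOrder isDecPartialOrder public using (_≤?_)

  El : Set
  El = Fin n

  _<_ : El → El → Set
  x < y = (x ≤ y) × (x ≢ y)

  _<?_ : ∀ x y → Dec (x < y)
  x <? y = (x ≤? y) ×-dec ¬? (x ≟F y)

  -- pairwise incomparable list of elements (incomparability also forces distinctness)
  Incomparable : El → El → Set
  Incomparable a b = ¬ (a ≤ b) × ¬ (b ≤ a)

  data Ext : Set where
    ⊥̂ ⊤̂ : Ext
    el   : El → Ext

  _<̂_ : Ext → Ext → Set
  ⊥̂    <̂ ⊥̂    = ⊥
  ⊥̂    <̂ ⊤̂    = ⊤
  ⊥̂    <̂ el _ = ⊤
  ⊤̂    <̂ _    = ⊥
  el _ <̂ ⊥̂    = ⊥
  el _ <̂ ⊤̂    = ⊤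
  el p <̂ el q = p < q

  _<̂?_ : ∀ x y → Dec (x <̂ y)
  ⊥̂    <̂? ⊥̂    = no λ ()
  ⊥̂    <̂? ⊤̂    = yes tt
  ⊥̂    <̂? el _ = yes tt
  ⊤̂    <̂? ⊥̂    = no λ ()
  ⊤̂    <̂? ⊤̂    = no λ ()
  ⊤̂    <̂? el _ = no λ ()
  el _ <̂? ⊥̂    = no λ ()
  el _ <̂? ⊤̂    = yes tt
  el p <̂? el q = p <? q

  allExt : List Ext
  allExt = ⊥̂ ∷ ⊤̂ ∷ map el (Data.List.allFin n)
    where import Data.List

  _⋖_ : Ext → Ext → Set
  u ⋖ v = (u <̂ v) × All (λ w → ¬ ((u <̂ w) × (w <̂ v))) allExt

  _⋖?_ : ∀ u v → Dec (u ⋖ v)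
  u ⋖? v = (u <̂? v) ×-dec all? (λ w → ¬? ((u <̂? w) ×-dec (w <̂? v))) allExt

  lowerCovers upperCovers : El → List Ext
  lowerCovers v = filter (λ u → u ⋖? el v) allExt
  upperCovers v = filter (λ u → el v ⋖? u) allExt

  Below : List El → El → Set
  Below S x = ∃ λ y → (y ∈ S) × (x < y)

  record IsLinExt (D : El → Set) (xs : List El) : Set where
    field
      unique   : Unique xs
      sound    : ∀ x → x ∈ xs → D x
      complete : ∀ x → D x → x ∈ xs
      ordered  : ∀ a b → lookup xs a < lookup xs b → a Fin.< b

  LinExt : (El → Set) → Set
  LinExt D = Σ (List El) (IsLinExt D)

module Toggles {c ℓ} (P : FinPoset) (S : SkewField c ℓ) (C : SkewField.Carrier S) where
  open FinPoset P
  open SkewField S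

  Labeling : Set c
  Labeling = El → Carrier

  _≈L_ : Labeling → Labeling → Set ℓ
  f ≈L g = ∀ x → f x ≈ g x

  -- a partial map S^P ⇀ S^P, given by its graph
  PMap : Set (lsuc (c ⊔ ℓ))
  PMap = Labeling → Labeling → Set (c ⊔ ℓ)

  idP : PMap
  idP f g = Level.Lift (c ⊔ ℓ) (f ≈L g)

  _∘P_ : PMap → PMap → PMap
  (R ∘P Q) f h = ∃ λ g → Q f g × R g h

  -- equality of partial maps: they agree wherever both are defined
  _≐_ : PMap → PMap → Set (c ⊔ ℓ)
  R ≐ Q = ∀ f g h → R f g → Q f h → g ≈L h

  ΣS : List Carrier → Carrier
  ΣS = foldr _+_ 0#

  ParSum : List Carrier → Carrier → Set (c ⊔ ℓ)
  ParSum zs w = ∃ λ ys → Pointwise Inv zs ys × Inv (ΣS ys) w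

  ext : Labeling → Ext → Carrier
  ext f ⊥̂      = 1#
  ext f ⊤̂      = C
  ext f (el p) = f p

  lowSum : Labeling → El → Carrier
  lowSum f v = ΣS (map (ext f) (lowerCovers v))

  upLabels : Labeling → El → List Carrier
  upLabels f v = map (ext f) (upperCovers v)

  T : El → PMap
  T v f g = (∀ u → u ≢ v → g u ≈ f u)
          × ∃ λ a → Inv (f v) a × ∃ λ b → ParSum (upLabels f v) b
          × (g v ≈ (lowSum f v * a) * b)

  E : El → PMap
  E v f g = (∀ u → u ≢ v → g u ≈ f u)
          × ∃ λ a → Inv (f v) a × ∃ λ b → ParSum (upLabels f v) b
          × (g v ≈ (b * a) * lowSum f v)

  Tprod : List El → PMap
  Tprod = foldr (λ x R → T x ∘P R) idP

  Eprod : List El → PMap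
  Eprod = foldr (λ x R → R ∘P E x) idP

  η : ∀ {Sv} → LinExt (Below Sv) → PMap
  η (xs , _) = Tprod xs

  η⁻¹ : ∀ {Sv} → LinExt (Below Sv) → PMap
  η⁻¹ (xs , _) = Eprod xs

  τ* : (v : El) → LinExt (Below (v ∷ [])) → PMap
  τ* v L = (η L ∘P T v) ∘P η⁻¹ L

  τ*prod : (ws : List El) → All (λ v → LinExt (Below (v ∷ []))) ws → PMap
  τ*prod []       []       = idP
  τ*prod (w ∷ ws) (L ∷ Ls) = τ* w L ∘P τ*prod ws Ls

{-# OPTIONS --safe #-}
module Submission where

-- Products of toggles T_v and elggots E_v are modelled by words in the letters
-- `toggle at v` and `elggot at v`, read right to left as in the paper.  Two rewrite rules
-- are sound for the partial maps the words denote: adjacent letters at incomparable sites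
-- commute, and E_v T_v cancels.  Any two linear extensions of the same set give words
-- that differ only by commutations.
--
-- The theorem follows by induction on the list w ∷ ws of incomparable elements.  Let L and
-- M' be linear extensions of the sets below w and below ws.  Splitting L = A B, where A is
-- the part below ws, and M' = A B', where B' is the part not below w,
--   τ*_w η_M' T_ws η_M'⁻¹ ∼ η_L T_w η_B⁻¹ η_A⁻¹ η_A η_B' T_ws η_M'⁻¹
--                        ⇝ η_L T_w η_B⁻¹ η_B' T_ws η_M'⁻¹
--                        ∼ η_L η_B' T_w T_ws η_B⁻¹ η_M'⁻¹,
-- as B is incomparable to B' and to ws, and w to B'.  Both L B' and M' B are linear
-- extensions of the set below {w} ∪ ws.  A rewrite step can only enlarge the graph of the
-- partial map a word denotes, so the left-hand side is contained in the right-hand side,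
-- which is functional.

open import Defs
open import Data.List using (List; _∷_; []; take; length)
open import Data.List.Relation.Unary.All using (All)
open import Data.List.Relation.Unary.AllPairs using (AllPairs)

open import Level using (0ℓ; _⊔_; lift)
open import Algebra.Bundles using (Monoid)
open import Data.Empty using (⊥-elim)
open import Data.Fin.Properties using (_≟_) renaming (<-asym to <-asymᶠ)
open import Data.List using (_++_; [_]; map; filter)
open import Data.List.Properties using (map-++; ++-assoc; ++-identityʳ; tabulate-lookup)
open import Data.List.Membership.Propositional using (_∈_; find; lose)
open import Data.List.Membership.Propositional.Properties
  using (∈-∃++; ∈-++⁻; ∈-++⁺ˡ; ∈-++⁺ʳ; ∈-filter⁺; ∈-filter⁻)
open import Data.List.Relation.Unary.Any using (here; there; any?)
open import Data.List.Relation.Unary.Any.Properties using (¬Any[])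
open import Data.List.Relation.Unary.All using ([]; _∷_)
import Data.List.Relation.Unary.All as All
import Data.List.Relation.Unary.All.Properties as All
open import Data.List.Relation.Unary.AllPairs using ([]; _∷_)
import Data.List.Relation.Unary.AllPairs as AllPairs
import Data.List.Relation.Unary.AllPairs.Properties as AllPairs
open import Data.List.Relation.Binary.Pointwise as Pointwise using (Pointwise; []; _∷_)
open import Data.Product using (_×_; _,_; proj₁; proj₂; ∃; swap)
open import Data.Sum using (_⊎_; inj₁; inj₂)
import Data.Sum as Sum
open import Data.Vec.Functional using (updateAt)
open import Data.Vec.Functional.Properties using (updateAt-updates; updateAt-minimal)
open import Function using (_∘_; id)
open import Relation.Binary.Core using (Rel; _⇒_)
open import Relation.Binary.Construct.Closure.ReflexiveTransitive as Star
  using (Star; ε; _◅_; _◅◅_)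
open import Relation.Binary.Construct.Closure.ReflexiveTransitive.Properties
  using (module StarReasoning)
import Relation.Binary.Construct.NonStrictToStrict as NonStrictToStrict
open import Relation.Binary.PropositionalEquality using (_≡_; _≢_; refl)
import Relation.Binary.PropositionalEquality as ≡
open import Relation.Binary.Structures using (IsDecPartialOrder)
open import Relation.Nullary using (¬_; yes; no)
open import Relation.Nullary.Decidable using (map′; toSum)
open import Relation.Unary using (Pred; Decidable; _⊆_; _∪_; _∩_; ∁; _≐_)
open import Relation.Unary.Properties using (∁?)

module MonoidInverses {c ℓ} (M : Monoid c ℓ) where
  open Monoid M using (Carrier; _≈_; assoc; identityˡ; setoid)
    renaming (_∙_ to _*_; ∙-cong to *-cong; ε to 1#; refl to ≈-refl; sym to ≈-sym; trans to ≈-trans)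
  open import Algebra.Properties.Monoid M using (elimʳ; cancelˡ; insertʳ)
  open import Relation.Binary.Reasoning.Setoid setoid

  IsInverse : Carrier → Carrier → Set ℓ
  IsInverse x y = (x * y ≈ 1#) × (y * x ≈ 1#)

  inverse-resp : ∀ {x x' y y'} → x ≈ x' → y ≈ y' → IsInverse x y → IsInverse x' y'
  inverse-resp x≈x' y≈y' (xy≈1 , yx≈1) =
    ≈-trans (*-cong (≈-sym x≈x') (≈-sym y≈y')) xy≈1 ,
    ≈-trans (*-cong (≈-sym y≈y') (≈-sym x≈x')) yx≈1

  inverse-unique : ∀ {x x' y y'} → x ≈ x' → IsInverse x y → IsInverse x' y' → y ≈ y'
  inverse-unique {x} {_} {y} {y'} x≈x' (_ , yx≈1) (x'y'≈1 , _) = begin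
    y             ≈⟨ elimʳ (≈-trans (*-cong x≈x' ≈-refl) x'y'≈1) y ⟨
    y * (x * y')  ≈⟨ cancelˡ yx≈1 y' ⟩
    y'            ∎

  -- With a = x⁻¹, b = β⁻¹ and a' = ((L a) b)⁻¹, the elggot formula (b a') L undoes the
  -- toggle formula (L a) b.
  cancel-sandwich : ∀ {x a b β L a'} → a * x ≈ 1# → b * β ≈ 1# → a' * ((L * a) * b) ≈ 1# →
                    (b * a') * L ≈ x
  cancel-sandwich {x} {a} {b} {β} {L} {a'} ax≈1 bβ≈1 a'[Lab]≈1 = begin
    (b * a') * L  ≈⟨ assoc b a' L ⟩
    b * (a' * L)  ≈⟨ *-cong ≈-refl a'L≈βx ⟩
    b * (β * x)   ≈⟨ cancelˡ bβ≈1 x ⟩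
    x             ∎
    where
    a'La·b≈1 : ((a' * L) * a) * b ≈ 1#
    a'La·b≈1 = ≈-trans (*-cong (assoc a' L a) ≈-refl) (≈-trans (assoc a' (L * a) b) a'[Lab]≈1)
    a'L≈βx : a' * L ≈ β * x
    a'L≈βx = begin
      a' * L                          ≈⟨ insertʳ ax≈1 (a' * L) ⟩
      ((a' * L) * a) * x              ≈⟨ *-cong (insertʳ bβ≈1 _) ≈-refl ⟩
      ((((a' * L) * a) * b) * β) * x  ≈⟨ *-cong (*-cong a'La·b≈1 ≈-refl) ≈-refl ⟩
      (1# * β) * x                    ≈⟨ *-cong (identityˡ β) ≈-refl ⟩
      β * x                           ∎

AllPairs-++⁻ : ∀ {a r} {A : Set a} {R : Rel A r} xs {ys} → AllPairs R (xs ++ ys) →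
               AllPairs R xs × AllPairs R ys × All (λ x → All (R x) ys) xs
AllPairs-++⁻ []       p          = [] , p , []
AllPairs-++⁻ (_ ∷ xs) (px ∷ pxs) =
  let rx-xs , rx-ys = All.++⁻ xs px
      p-xs , p-ys , across = AllPairs-++⁻ xs pxs
  in  rx-xs ∷ p-xs , p-ys , rx-ys ∷ across

AllPairs-delete : ∀ {a r} {A : Set a} {R : Rel A r} xs {x ys} →
                  AllPairs R (xs ++ x ∷ ys) → AllPairs R (xs ++ ys)
AllPairs-delete xs p with AllPairs-++⁻ xs p
... | p-xs , _ ∷ p-ys , across = AllPairs.++⁺ p-xs p-ys (All.map All.tail across)

module Words (P : FinPoset) where
  open FinPoset P
  open IsDecPartialOrder isDecPartialOrder using (antisym; ≤-respˡ-≈) renaming (trans to ≤-trans)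
  open NonStrictToStrict _≡_ _≤_ using (≤-<-trans)

  DownClosed : Pred El 0ℓ → Set
  DownClosed Q = ∀ {x z} → z ≤ x → Q x → Q z

  Below-downClosed : ∀ Sv → DownClosed (Below Sv)
  Below-downClosed Sv z≤x (y , y∈Sv , x<y) =
    y , y∈Sv , ≤-<-trans ≤-trans antisym ≤-respˡ-≈ z≤x x<y

  below? : ∀ Sv → Decidable (Below Sv)
  below? Sv x = map′ find (λ (y , y∈Sv , x<y) → lose y∈Sv x<y) (any? (x <?_) Sv)

  Below-++⁻ : ∀ Sv {Sv'} → Below (Sv ++ Sv') ⊆ Below Sv ∪ Below Sv'
  Below-++⁻ Sv (y , y∈ , x<y) =
    Sum.map (λ y∈Sv → y , y∈Sv , x<y) (λ y∈Sv' → y , y∈Sv' , x<y) (∈-++⁻ Sv y∈)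

  Below-++⁺ˡ : ∀ {Sv Sv'} → Below Sv ⊆ Below (Sv ++ Sv')
  Below-++⁺ˡ (y , y∈Sv , x<y) = y , ∈-++⁺ˡ y∈Sv , x<y

  Below-++⁺ʳ : ∀ Sv {Sv'} → Below Sv' ⊆ Below (Sv ++ Sv')
  Below-++⁺ʳ Sv (y , y∈Sv' , x<y) = y , ∈-++⁺ʳ Sv y∈Sv' , x<y

  Below-[_] : ∀ w {z} → Below [ w ] z → z < w
  Below-[ w ] (_ , here refl , z<w) = z<w

  -- Words and their rewriting

  data Kind : Set where
    toggle elggot : Kind

  opposite : Kind → Kind
  opposite toggle = elggot
  opposite elggot = toggle

  infix 6 _at_
  record Letter : Set where
    constructor _at_
    field
      kind : Kind
      site : El
  open Letter public

  Word : Set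
  Word = List Letter

  _⁻ : Letter → Letter
  (k at v) ⁻ = opposite k at v

  infixl 10 _⁻¹
  _⁻¹ : Word → Word
  [] ⁻¹      = []
  (a ∷ u) ⁻¹ = u ⁻¹ ++ [ a ⁻ ]

  ⟪_⟫ : List El → Word
  ⟪_⟫ = map (toggle at_)

  ⁻¹-++ : ∀ u v → (u ++ v) ⁻¹ ≡ v ⁻¹ ++ u ⁻¹
  ⁻¹-++ []      v = ≡.sym (++-identityʳ (v ⁻¹))
  ⁻¹-++ (a ∷ u) v = ≡.trans (≡.cong (_++ [ a ⁻ ]) (⁻¹-++ u v)) (++-assoc (v ⁻¹) (u ⁻¹) _)

  ⟪⟫⁻¹-++ : ∀ xs ys → ⟪ xs ++ ys ⟫ ⁻¹ ≡ ⟪ ys ⟫ ⁻¹ ++ ⟪ xs ⟫ ⁻¹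
  ⟪⟫⁻¹-++ xs ys = ≡.trans (≡.cong _⁻¹ (map-++ _ xs ys)) (⁻¹-++ ⟪ xs ⟫ ⟪ ys ⟫)

  data Commute : Rel Word 0ℓ where
    here  : ∀ {a b s} → Incomparable (site a) (site b) → Commute (a ∷ b ∷ s) (b ∷ a ∷ s)
    there : ∀ {a u v} → Commute u v → Commute (a ∷ u) (a ∷ v)

  infix 4 _∼_
  _∼_ : Rel Word 0ℓ
  _∼_ = Star Commute

  module ∼-Reasoning = StarReasoning Commute

  Commute-sym : ∀ {u v} → Commute u v → Commute v u
  Commute-sym (here a#b) = here (swap a#b)
  Commute-sym (there c)  = there (Commute-sym c)

  Commute-prefix : ∀ p {u v} → Commute u v → Commute (p ++ u) (p ++ v)
  Commute-prefix []      c = c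
  Commute-prefix (a ∷ p) c = there (Commute-prefix p c)

  Commute-suffix : ∀ s {u v} → Commute u v → Commute (u ++ s) (v ++ s)
  Commute-suffix s (here a#b) = here a#b
  Commute-suffix s (there c)  = there (Commute-suffix s c)

  Commute-⁻¹ : ∀ {u v} → Commute u v → Commute (u ⁻¹) (v ⁻¹)
  Commute-⁻¹ (here {s = s} a#b) =
    ≡.subst₂ Commute (≡.sym (++-assoc (s ⁻¹) _ _)) (≡.sym (++-assoc (s ⁻¹) _ _))
      (Commute-prefix (s ⁻¹) (here (swap a#b)))
  Commute-⁻¹ (there {a} c) = Commute-suffix [ a ⁻ ] (Commute-⁻¹ c)

  ∼-sym : ∀ {u v} → u ∼ v → v ∼ u
  ∼-sym = Star.reverse Commute-sym

  ∼-prefix : ∀ p {u v} → u ∼ v → p ++ u ∼ p ++ v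
  ∼-prefix p = Star.gmap (p ++_) (Commute-prefix p)

  ∼-suffix : ∀ s {u v} → u ∼ v → u ++ s ∼ v ++ s
  ∼-suffix s = Star.gmap (_++ s) (Commute-suffix s)

  ∼-⁻¹ : ∀ {u v} → u ∼ v → u ⁻¹ ∼ v ⁻¹
  ∼-⁻¹ = Star.gmap _⁻¹ Commute-⁻¹

  Independent : Word → Word → Set
  Independent u v = All (λ a → All (λ b → Incomparable (site a) (site b)) v) u

  ⟪⟫-independent : ∀ {xs ys} → All (λ x → All (Incomparable x) ys) xs →
                   Independent ⟪ xs ⟫ ⟪ ys ⟫
  ⟪⟫-independent = All.map⁺ ∘ All.map All.map⁺

  ⁻¹-independent : ∀ {u v} → Independent u v → Independent (u ⁻¹) v
  ⁻¹-independent []          = []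
  ⁻¹-independent (a#v ∷ u#v) = All.++⁺ (⁻¹-independent u#v) (a#v ∷ [])

  independent-commute : ∀ u v {s} → Independent u v → u ++ v ++ s ∼ v ++ u ++ s
  independent-commute []      v _           = ε
  independent-commute (a ∷ u) v (a#v ∷ u#v) =
    ∼-prefix [ a ] (independent-commute u v u#v) ◅◅ letter-commute v a#v
    where
    letter-commute : ∀ v {t} → All (λ b → Incomparable (site a) (site b)) v →
                     a ∷ v ++ t ∼ v ++ a ∷ t
    letter-commute []      _           = ε
    letter-commute (b ∷ v) (a#b ∷ a#v) = here a#b ◅ ∼-prefix [ b ] (letter-commute v a#v)

  data Reduce : Rel Word 0ℓ where
    commute : ∀ {u v} → Commute u v → Reduce u v
    cancel  : ∀ {v s} → Reduce (elggot at v ∷ toggle at v ∷ s) s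
    there   : ∀ {a u v} → Reduce u v → Reduce (a ∷ u) (a ∷ v)

  infix 4 _⇝_
  _⇝_ : Rel Word 0ℓ
  _⇝_ = Star Reduce

  module ⇝-Reasoning = StarReasoning Reduce

  commutes : ∀ {u v} → u ∼ v → u ⇝ v
  commutes = Star.map commute

  Reduce-prefix : ∀ p {u v} → Reduce u v → Reduce (p ++ u) (p ++ v)
  Reduce-prefix []      r = r
  Reduce-prefix (a ∷ p) r = there (Reduce-prefix p r)

  ⇝-prefix : ∀ p {u v} → u ⇝ v → p ++ u ⇝ p ++ v
  ⇝-prefix p = Star.gmap (p ++_) (Reduce-prefix p)

  cancel-⟪⟫ : ∀ xs {s} → ⟪ xs ⟫ ⁻¹ ++ ⟪ xs ⟫ ++ s ⇝ s
  cancel-⟪⟫ []           = ε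
  cancel-⟪⟫ (x ∷ xs) {s} = begin
    (⟪ xs ⟫ ⁻¹ ++ [ elggot at x ]) ++ toggle at x ∷ ⟪ xs ⟫ ++ s  ≡⟨ ++-assoc (⟪ xs ⟫ ⁻¹) _ _ ⟩
    ⟪ xs ⟫ ⁻¹ ++ elggot at x ∷ toggle at x ∷ ⟪ xs ⟫ ++ s
      ⟶⟨ Reduce-prefix (⟪ xs ⟫ ⁻¹) cancel ⟩
    ⟪ xs ⟫ ⁻¹ ++ ⟪ xs ⟫ ++ s                                    ⟶*⟨ cancel-⟪⟫ xs ⟩
    s                                                           ∎
    where open ⇝-Reasoning

  -- Linear extensions

  record IsLinearExtension (D : Pred El 0ℓ) (xs : List El) : Set where
    field
      distinct : AllPairs _≢_ xs
      sorted   : AllPairs (λ x y → ¬ y < x) xs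
      sound    : ∀ {x} → x ∈ xs → D x
      complete : ∀ {x} → D x → x ∈ xs
  open IsLinearExtension

  isLinearExtension : ∀ {D xs} → IsLinExt D xs → IsLinearExtension D xs
  isLinearExtension {xs = xs} e = record
    { distinct = IsLinExt.unique e
    ; sorted   = ≡.subst (AllPairs _) (tabulate-lookup xs) (AllPairs.tabulate⁺-< λ i<j xⱼ<xᵢ →
                   <-asymᶠ i<j (IsLinExt.ordered e _ _ xⱼ<xᵢ))
    ; sound    = IsLinExt.sound e _
    ; complete = IsLinExt.complete e _
    }

  IsLinearExtension-resp : ∀ {D D' xs} → D ≐ D' → IsLinearExtension D xs →
                           IsLinearExtension D' xs
  IsLinearExtension-resp (D⊆D' , D'⊆D) e = record
    { distinct = distinct e
    ; sorted   = sorted e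
    ; sound    = D⊆D' ∘ sound e
    ; complete = complete e ∘ D'⊆D
    }

  filter-isLinearExtension : ∀ {D Q xs} (Q? : Decidable Q) → IsLinearExtension D xs →
                             IsLinearExtension (D ∩ Q) (filter Q? xs)
  filter-isLinearExtension {xs = xs} Q? e = record
    { distinct = AllPairs.filter⁺ Q? (distinct e)
    ; sorted   = AllPairs.filter⁺ Q? (sorted e)
    ; sound    = λ x∈ → let x∈xs , q = ∈-filter⁻ Q? {xs = xs} x∈ in sound e x∈xs , q
    ; complete = λ (d , q) → ∈-filter⁺ Q? (complete e d) q
    }

  ++-isLinearExtension : ∀ {Q D₁ D₂ xs ys} → DownClosed Q → D₁ ⊆ Q → D₂ ⊆ ∁ Q →
                         IsLinearExtension D₁ xs → IsLinearExtension D₂ ys →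
                         IsLinearExtension (D₁ ∪ D₂) (xs ++ ys)
  ++-isLinearExtension {Q} {xs = xs} {ys} Q-closed D₁⊆Q D₂⊆∁Q e₁ e₂ = record
    { distinct = AllPairs.++⁺ (distinct e₁) (distinct e₂) (across λ q ¬q x≡y → ¬q (≡.subst Q x≡y q))
    ; sorted   = AllPairs.++⁺ (sorted e₁) (sorted e₂) (across λ q ¬q y<x → ¬q (Q-closed (proj₁ y<x) q))
    ; sound    = Sum.map (sound e₁) (sound e₂) ∘ ∈-++⁻ xs
    ; complete = Sum.[ ∈-++⁺ˡ ∘ complete e₁ , ∈-++⁺ʳ xs ∘ complete e₂ ]
    }
    where
    across : ∀ {R : Rel El 0ℓ} → (∀ {x y} → Q x → ¬ Q y → R x y) → All (λ x → All (R x) ys) xs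
    across r = All.tabulate λ x∈ → All.tabulate λ y∈ →
                 r (D₁⊆Q (sound e₁ x∈)) (D₂⊆∁Q (sound e₂ y∈))

  delete-isLinearExtension : ∀ pre {D x post} → IsLinearExtension D (pre ++ x ∷ post) →
                             IsLinearExtension (λ z → D z × z ≢ x) (pre ++ post)
  delete-isLinearExtension pre {x = x} {post} e = record
    { distinct = AllPairs-delete pre (distinct e)
    ; sorted   = AllPairs-delete pre (sorted e)
    ; sound    = λ z∈ → sound e (reinsert z∈) , ≢x z∈
    ; complete = λ (d , z≢x) → remove (complete e d) z≢x
    }
    where
    reinsert : ∀ {z} → z ∈ pre ++ post → z ∈ pre ++ x ∷ post
    reinsert = Sum.[ ∈-++⁺ˡ , ∈-++⁺ʳ pre ∘ there ] ∘ ∈-++⁻ pre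
    remove : ∀ {z} → z ∈ pre ++ x ∷ post → z ≢ x → z ∈ pre ++ post
    remove z∈ z≢x with ∈-++⁻ pre z∈
    ... | inj₁ z∈pre          = ∈-++⁺ˡ z∈pre
    ... | inj₂ (here z≡x)     = ⊥-elim (z≢x z≡x)
    ... | inj₂ (there z∈post) = ∈-++⁺ʳ pre z∈post
    ≢x : ∀ {z} → z ∈ pre ++ post → z ≢ x
    ≢x z∈ with AllPairs-++⁻ pre (distinct e) | ∈-++⁻ pre z∈
    ... | _ , _ , pre≢        | inj₁ z∈pre  = All.head (All.lookup pre≢ z∈pre)
    ... | _ , x≢post ∷ _ , _ | inj₂ z∈post = ≡.≢-sym (All.lookup x≢post z∈post)

  linear-extensions-commute : ∀ {D} xs {ys} → IsLinearExtension D xs → IsLinearExtension D ys →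
                              ⟪ xs ⟫ ∼ ⟪ ys ⟫
  linear-extensions-commute []       {[]}    _ _  = ε
  linear-extensions-commute []       {_ ∷ _} e e' = ⊥-elim (¬Any[] (complete e (sound e' (here refl))))
  linear-extensions-commute (x ∷ xs) e e'
    with pre , post , refl ← ∈-∃++ (complete e' (sound e (here refl))) = begin
      toggle at x ∷ ⟪ xs ⟫
        ⟶*⟨ ∼-prefix [ toggle at x ] (linear-extensions-commute xs e₋ e'₋) ⟩
      toggle at x ∷ ⟪ pre ++ post ⟫
        ≡⟨ ≡.cong (toggle at x ∷_) (map-++ _ pre post) ⟩
      toggle at x ∷ ⟪ pre ⟫ ++ ⟪ post ⟫
        ⟶*⟨ independent-commute [ toggle at x ] ⟪ pre ⟫ (⟪⟫-independent (x#pre ∷ [])) ⟩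
      ⟪ pre ⟫ ++ toggle at x ∷ ⟪ post ⟫
        ≡⟨ map-++ _ pre (x ∷ post) ⟨
      ⟪ pre ++ x ∷ post ⟫
        ∎
    where
    open ∼-Reasoning
    e₋  = delete-isLinearExtension [] e
    e'₋ = delete-isLinearExtension pre e'
    -- x is minimal in D, and it comes after every element of pre in ys
    x#pre : All (Incomparable x) pre
    x#pre = All.tabulate λ p∈pre →
      let p≢x  = proj₂ (sound e'₋ (∈-++⁺ˡ p∈pre))
          p∈xs = complete e₋ (sound e' (∈-++⁺ˡ p∈pre) , p≢x)
          _ , _ , pre-before-x = AllPairs-++⁻ pre (sorted e')
      in  (λ x≤p → All.head (All.lookup pre-before-x p∈pre) (x≤p , ≡.≢-sym p≢x))
        , (λ p≤x → All.lookup (AllPairs.head (sorted e)) p∈xs (p≤x , p≢x))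

  split-⟪⟫ : ∀ {D xs} ys {zs r} → IsLinearExtension D xs → IsLinearExtension D (ys ++ zs) →
             ⟪ xs ⟫ ++ r ∼ ⟪ ys ⟫ ++ ⟪ zs ⟫ ++ r
  split-⟪⟫ {xs = xs} ys {zs} {r} e e' =
    ≡.subst (⟪ xs ⟫ ++ r ∼_) (≡.trans (≡.cong (_++ r) (map-++ _ ys zs)) (++-assoc ⟪ ys ⟫ _ r))
      (∼-suffix r (linear-extensions-commute xs e e'))

  split-⟪⟫⁻¹ : ∀ {D xs} ys {zs r} → IsLinearExtension D xs → IsLinearExtension D (ys ++ zs) →
               ⟪ xs ⟫ ⁻¹ ++ r ∼ ⟪ zs ⟫ ⁻¹ ++ ⟪ ys ⟫ ⁻¹ ++ r
  split-⟪⟫⁻¹ {xs = xs} ys {zs} {r} e e' =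
    ≡.subst (⟪ xs ⟫ ⁻¹ ++ r ∼_)
      (≡.trans (≡.cong (_++ r) (⟪⟫⁻¹-++ ys zs)) (++-assoc (⟪ zs ⟫ ⁻¹) _ r))
      (∼-suffix r (∼-⁻¹ (linear-extensions-commute xs e e')))

  -- Merging two conjugates

  differences-incomparable : ∀ {Q₁ Q₂ b b'} → DownClosed Q₁ → DownClosed Q₂ →
                             Q₁ b → ¬ Q₂ b → Q₂ b' → ¬ Q₁ b' → Incomparable b b'
  differences-incomparable Q₁-closed Q₂-closed q₁b ¬q₂b q₂b' ¬q₁b' =
    (λ b≤b' → ¬q₂b (Q₂-closed b≤b' q₂b')) , (λ b'≤b → ¬q₁b' (Q₁-closed b'≤b q₁b))

  module _ {w ws} (w#ws : All (Incomparable w) ws) where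

    below-w-only#ws : ∀ {b y} → Below [ w ] b → ¬ Below ws b → y ∈ ws → Incomparable b y
    below-w-only#ws {b} {y} b<w ¬b<ws y∈ws = b≰y , y≰b
      where
      y≰w : ¬ y ≤ w
      y≰w = proj₂ (All.lookup w#ws y∈ws)
      b≰y : ¬ b ≤ y
      b≰y b≤y with b ≟ y
      ... | yes refl = y≰w (proj₁ (Below-[ w ] b<w))
      ... | no  b≢y  = ¬b<ws (y , y∈ws , b≤y , b≢y)
      y≰b : ¬ y ≤ b
      y≰b y≤b = y≰w (≤-trans y≤b (proj₁ (Below-[ w ] b<w)))

    w#below-ws-only : ∀ {b} → Below ws b → ¬ Below [ w ] b → Incomparable w b
    w#below-ws-only {b} (y , y∈ws , b<y) ¬b<w = w≰b , b≰w
      where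
      w≰y : ¬ w ≤ y
      w≰y = proj₁ (All.lookup w#ws y∈ws)
      w≰b : ¬ w ≤ b
      w≰b w≤b = w≰y (≤-trans w≤b (proj₁ b<y))
      b≰w : ¬ b ≤ w
      b≰w b≤w with b ≟ w
      ... | yes refl = w≰y (proj₁ b<y)
      ... | no  b≢w  = ¬b<w (w , here refl , b≤w , b≢w)

  module _ {w ws L M' M} (w#ws : All (Incomparable w) ws)
           (L-ext : IsLinearExtension (Below [ w ]) L)
           (M'-ext : IsLinearExtension (Below ws) M')
           (M-ext : IsLinearExtension (Below (w ∷ ws)) M) where
    private
      A B B' : List El
      A  = filter (below? ws) L
      B  = filter (∁? (below? ws)) L
      B' = filter (∁? (below? [ w ])) M'

      A-ext  = filter-isLinearExtension (below? ws) L-ext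
      B-ext  = filter-isLinearExtension (∁? (below? ws)) L-ext
      B'-ext = filter-isLinearExtension (∁? (below? [ w ])) M'-ext

      AB-ext : IsLinearExtension (Below [ w ]) (A ++ B)
      AB-ext = IsLinearExtension-resp
        ( Sum.[ proj₁ , proj₁ ]
        , λ {z} z<w → Sum.map (z<w ,_) (z<w ,_) (toSum (below? ws z)))
        (++-isLinearExtension (Below-downClosed ws) proj₂ proj₂ A-ext B-ext)

      AB'-ext : IsLinearExtension (Below ws) (A ++ B')
      AB'-ext = IsLinearExtension-resp
        ( Sum.[ proj₂ , proj₁ ]
        , λ {z} z<ws → Sum.map (_, z<ws) (z<ws ,_) (toSum (below? [ w ] z)))
        (++-isLinearExtension (Below-downClosed [ w ]) proj₁ proj₂ A-ext B'-ext)

      LB'-ext : IsLinearExtension (Below (w ∷ ws)) (L ++ B')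
      LB'-ext = IsLinearExtension-resp
        ( Sum.[ Below-++⁺ˡ , Below-++⁺ʳ [ w ] ∘ proj₁ ]
        , λ {z} → Sum.[ inj₁ , (λ z<ws → Sum.map id (z<ws ,_) (toSum (below? [ w ] z))) ]
                  ∘ Below-++⁻ [ w ])
        (++-isLinearExtension (Below-downClosed [ w ]) id proj₂ L-ext B'-ext)

      M'B-ext : IsLinearExtension (Below (w ∷ ws)) (M' ++ B)
      M'B-ext = IsLinearExtension-resp
        ( Sum.[ Below-++⁺ʳ [ w ] , Below-++⁺ˡ ∘ proj₁ ]
        , λ {z} → Sum.[ (λ z<w → Sum.map id (z<w ,_) (toSum (below? ws z))) , inj₁ ]
                  ∘ Below-++⁻ [ w ])
        (++-isLinearExtension (Below-downClosed ws) id proj₂ M'-ext B-ext)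

      B⁻¹#B' : Independent (⟪ B ⟫ ⁻¹) ⟪ B' ⟫
      B⁻¹#B' = ⁻¹-independent (⟪⟫-independent (All.tabulate λ b∈B → All.tabulate λ b'∈B' →
        let b<w , ¬b<ws = sound B-ext b∈B ; b'<ws , ¬b'<w = sound B'-ext b'∈B'
        in  differences-incomparable (Below-downClosed [ w ]) (Below-downClosed ws)
              b<w ¬b<ws b'<ws ¬b'<w))

      B⁻¹#ws : Independent (⟪ B ⟫ ⁻¹) ⟪ ws ⟫
      B⁻¹#ws = ⁻¹-independent (⟪⟫-independent (All.tabulate λ b∈B →
        let b<w , ¬b<ws = sound B-ext b∈B in All.tabulate (below-w-only#ws w#ws b<w ¬b<ws)))

      w#B' : Independent [ toggle at w ] ⟪ B' ⟫
      w#B' = ⟪⟫-independent (All.tabulate (λ b'∈B' →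
        let b'<ws , ¬b'<w = sound B'-ext b'∈B' in w#below-ws-only w#ws b'<ws ¬b'<w) ∷ [])

      cancel-common-part : ∀ {r} → ⟪ L ⟫ ⁻¹ ++ ⟪ M' ⟫ ++ r ⇝ ⟪ B ⟫ ⁻¹ ++ ⟪ B' ⟫ ++ r
      cancel-common-part {r} = begin
        ⟪ L ⟫ ⁻¹ ++ ⟪ M' ⟫ ++ r
          ⟶*⟨ commutes (split-⟪⟫⁻¹ A L-ext AB-ext) ⟩
        ⟪ B ⟫ ⁻¹ ++ ⟪ A ⟫ ⁻¹ ++ ⟪ M' ⟫ ++ r
          ⟶*⟨ commutes (∼-prefix (⟪ B ⟫ ⁻¹) (∼-prefix (⟪ A ⟫ ⁻¹) (split-⟪⟫ A M'-ext AB'-ext))) ⟩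
        ⟪ B ⟫ ⁻¹ ++ ⟪ A ⟫ ⁻¹ ++ ⟪ A ⟫ ++ ⟪ B' ⟫ ++ r
          ⟶*⟨ ⇝-prefix (⟪ B ⟫ ⁻¹) (cancel-⟪⟫ A) ⟩
        ⟪ B ⟫ ⁻¹ ++ ⟪ B' ⟫ ++ r
          ∎
        where open ⇝-Reasoning

      pass-over-B' : ∀ {r} → toggle at w ∷ ⟪ B ⟫ ⁻¹ ++ ⟪ B' ⟫ ++ ⟪ ws ⟫ ++ r
                             ∼ ⟪ B' ⟫ ++ toggle at w ∷ ⟪ ws ⟫ ++ ⟪ B ⟫ ⁻¹ ++ r
      pass-over-B' {r} = begin
        toggle at w ∷ ⟪ B ⟫ ⁻¹ ++ ⟪ B' ⟫ ++ ⟪ ws ⟫ ++ r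
          ⟶*⟨ ∼-prefix [ toggle at w ] (independent-commute (⟪ B ⟫ ⁻¹) ⟪ B' ⟫ B⁻¹#B') ⟩
        toggle at w ∷ ⟪ B' ⟫ ++ ⟪ B ⟫ ⁻¹ ++ ⟪ ws ⟫ ++ r
          ⟶*⟨ ∼-prefix (toggle at w ∷ ⟪ B' ⟫) (independent-commute (⟪ B ⟫ ⁻¹) ⟪ ws ⟫ B⁻¹#ws) ⟩
        toggle at w ∷ ⟪ B' ⟫ ++ ⟪ ws ⟫ ++ ⟪ B ⟫ ⁻¹ ++ r
          ⟶*⟨ independent-commute [ toggle at w ] ⟪ B' ⟫ w#B' ⟩
        ⟪ B' ⟫ ++ toggle at w ∷ ⟪ ws ⟫ ++ ⟪ B ⟫ ⁻¹ ++ r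
          ∎
        where open ∼-Reasoning

    conjugates-merge : (⟪ L ⟫ ++ toggle at w ∷ ⟪ L ⟫ ⁻¹) ++ ⟪ M' ⟫ ++ ⟪ ws ⟫ ++ ⟪ M' ⟫ ⁻¹
                       ⇝ ⟪ M ⟫ ++ toggle at w ∷ ⟪ ws ⟫ ++ ⟪ M ⟫ ⁻¹
    conjugates-merge = begin
      (⟪ L ⟫ ++ toggle at w ∷ ⟪ L ⟫ ⁻¹) ++ ⟪ M' ⟫ ++ ⟪ ws ⟫ ++ ⟪ M' ⟫ ⁻¹
        ≡⟨ ++-assoc ⟪ L ⟫ _ _ ⟩
      ⟪ L ⟫ ++ toggle at w ∷ ⟪ L ⟫ ⁻¹ ++ ⟪ M' ⟫ ++ ⟪ ws ⟫ ++ ⟪ M' ⟫ ⁻¹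
        ⟶*⟨ ⇝-prefix ⟪ L ⟫ (⇝-prefix [ toggle at w ] cancel-common-part) ⟩
      ⟪ L ⟫ ++ toggle at w ∷ ⟪ B ⟫ ⁻¹ ++ ⟪ B' ⟫ ++ ⟪ ws ⟫ ++ ⟪ M' ⟫ ⁻¹
        ⟶*⟨ commutes (∼-prefix ⟪ L ⟫ pass-over-B') ⟩
      ⟪ L ⟫ ++ ⟪ B' ⟫ ++ toggle at w ∷ ⟪ ws ⟫ ++ ⟪ B ⟫ ⁻¹ ++ ⟪ M' ⟫ ⁻¹
        ⟶*⟨ commutes (∼-sym (split-⟪⟫ L M-ext LB'-ext)) ⟩
      ⟪ M ⟫ ++ toggle at w ∷ ⟪ ws ⟫ ++ ⟪ B ⟫ ⁻¹ ++ ⟪ M' ⟫ ⁻¹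
        ≡⟨ ≡.cong (λ u → ⟪ M ⟫ ++ toggle at w ∷ ⟪ ws ⟫ ++ u) (⟪⟫⁻¹-++ M' B) ⟨
      ⟪ M ⟫ ++ toggle at w ∷ ⟪ ws ⟫ ++ ⟪ M' ++ B ⟫ ⁻¹
        ⟶*⟨ commutes (∼-prefix ⟪ M ⟫ (∼-prefix (toggle at w ∷ ⟪ ws ⟫)
              (∼-⁻¹ (linear-extensions-commute (M' ++ B) M'B-ext M-ext)))) ⟩
      ⟪ M ⟫ ++ toggle at w ∷ ⟪ ws ⟫ ++ ⟪ M ⟫ ⁻¹
        ∎
      where open ⇝-Reasoning

module Semantics {c ℓ} (P : FinPoset) (S : SkewField c ℓ) (C : SkewField.Carrier S) where
  open FinPoset P
  open IsDecPartialOrder isDecPartialOrder using () renaming (refl to ≤-refl)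
  open SkewField S using (Carrier; _≈_; _*_; Inv; *-monoid; +-cong; *-cong; reflexive)
    renaming (refl to ≈-refl; sym to ≈-sym; trans to ≈-trans)
  open Toggles P S C
  open Words P
  open MonoidInverses *-monoid using (inverse-resp; inverse-unique; cancel-sandwich)
  open import Relation.Binary.Reasoning.Setoid (SkewField.setoid S)

  ΣS-cong : ∀ {xs ys} → Pointwise _≈_ xs ys → ΣS xs ≈ ΣS ys
  ΣS-cong = Pointwise.foldr⁺ +-cong ≈-refl

  inverses-unique : ∀ {zs zs' ys ys'} → Pointwise _≈_ zs zs' →
                    Pointwise Inv zs ys → Pointwise Inv zs' ys' → Pointwise _≈_ ys ys'
  inverses-unique []           []       []         = []
  inverses-unique (z≈z' ∷ zs≈) (i ∷ is) (i' ∷ is') =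
    inverse-unique z≈z' i i' ∷ inverses-unique zs≈ is is'

  ParSum-resp : ∀ {zs zs' b} → Pointwise _≈_ zs zs' → ParSum zs b → ParSum zs' b
  ParSum-resp zs≈zs' (ys , zs⁻¹≡ys , Σys⁻¹≡b) =
    ys ,
    Pointwise.transitive (λ z'≈z → inverse-resp (≈-sym z'≈z) ≈-refl)
      (Pointwise.symmetric ≈-sym zs≈zs') zs⁻¹≡ys ,
    Σys⁻¹≡b

  ParSum-cong : ∀ {zs zs' b b'} → Pointwise _≈_ zs zs' → ParSum zs b → ParSum zs' b' → b ≈ b'
  ParSum-cong zs≈zs' (_ , zs⁻¹≡ys , Σys⁻¹≡b) (_ , zs'⁻¹≡ys' , Σys'⁻¹≡b') =
    inverse-unique (ΣS-cong (inverses-unique zs≈zs' zs⁻¹≡ys zs'⁻¹≡ys')) Σys⁻¹≡b Σys'⁻¹≡b'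

  -- Toggles and elggots as local updates

  AgreeNear : El → Labeling → Labeling → Set ℓ
  AgreeNear v f f' = ∀ u → u < v ⊎ v < u → f u ≈ f' u

  ext-cong : ∀ {f f'} es → All (λ e → ext f e ≈ ext f' e) es →
             Pointwise _≈_ (map (ext f) es) (map (ext f') es)
  ext-cong []       []             = []
  ext-cong (_ ∷ es) (fe≈f'e ∷ es≈) = fe≈f'e ∷ ext-cong es es≈

  lowSum-cong : ∀ {v f f'} → AgreeNear v f f' → lowSum f v ≈ lowSum f' v
  lowSum-cong {v} {f} {f'} near =
    ΣS-cong (ext-cong _ (All.map below (All.all-filter (_⋖? el v) allExt)))
    where
    below : ∀ {e} → e ⋖ el v → ext f e ≈ ext f' e
    below {⊥̂}    _         = ≈-refl
    below {el u} (u<v , _) = near u (inj₁ u<v)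

  upLabels-cong : ∀ {v f f'} → AgreeNear v f f' → Pointwise _≈_ (upLabels f v) (upLabels f' v)
  upLabels-cong {v} {f} {f'} near = ext-cong _ (All.map above (All.all-filter (el v ⋖?_) allExt))
    where
    above : ∀ {e} → el v ⋖ e → ext f e ≈ ext f' e
    above {⊤̂}    _         = ≈-refl
    above {el u} (v<u , _) = near u (inj₂ v<u)

  formula : Kind → Carrier → Carrier → Carrier → Carrier
  formula toggle low a b = (low * a) * b
  formula elggot low a b = (b * a) * low

  formula-cong : ∀ k {L L' a a' b b'} → L ≈ L' → a ≈ a' → b ≈ b' →
                 formula k L a b ≈ formula k L' a' b'
  formula-cong toggle L≈L' a≈a' b≈b' = *-cong (*-cong L≈L' a≈a') b≈b'
  formula-cong elggot L≈L' a≈a' b≈b' = *-cong (*-cong b≈b' a≈a') L≈L'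

  NewLabel : Letter → Labeling → Carrier → Set (c ⊔ ℓ)
  NewLabel (k at v) f x =
    ∃ λ a → Inv (f v) a × ∃ λ b → ParSum (upLabels f v) b × (x ≈ formula k (lowSum f v) a b)

  -- act (toggle at v) and act (elggot at v) unfold to Toggles.T v and Toggles.E v.
  act : Letter → PMap
  act l f g = (∀ u → u ≢ site l → g u ≈ f u) × NewLabel l f (g (site l))

  NewLabel-resp : ∀ {l f x x'} → x ≈ x' → NewLabel l f x → NewLabel l f x'
  NewLabel-resp x≈x' (a , inv , b , par , x≈) = a , inv , b , par , ≈-trans (≈-sym x≈x') x≈

  NewLabel-local : ∀ {l f f' x} → AgreeNear (site l) f f' → f (site l) ≈ f' (site l) →
                   NewLabel l f x → NewLabel l f' x
  NewLabel-local {k at _} near fv≈f'v (a , inv , b , par , x≈) =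
    a , inverse-resp fv≈f'v ≈-refl inv , b , ParSum-resp (upLabels-cong near) par ,
    ≈-trans x≈ (formula-cong k (lowSum-cong near) ≈-refl ≈-refl)

  NewLabel-functional : ∀ {l f x x'} → NewLabel l f x → NewLabel l f x' → x ≈ x'
  NewLabel-functional {k at _} (a , inv , b , par , x≈) (a' , inv' , b' , par' , x'≈) =
    ≈-trans x≈ (≈-trans (formula-cong k ≈-refl (inverse-unique ≈-refl inv inv')
                                        (ParSum-cong (Pointwise.refl ≈-refl) par par'))
                        (≈-sym x'≈))

  Congruent : PMap → Set (c ⊔ ℓ)
  Congruent R = ∀ {f f' g g'} → f ≈L f' → g ≈L g' → R f g → R f' g'

  Functional : PMap → Set (c ⊔ ℓ)
  Functional R = ∀ {f g h} → R f g → R f h → g ≈L h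

  ≈L-refl : ∀ {f} → f ≈L f
  ≈L-refl _ = ≈-refl

  act-congruent : ∀ l → Congruent (act l)
  act-congruent l f≈f' g≈g' (g-off , new-label) =
    (λ u u≢v → ≈-trans (≈-sym (g≈g' u)) (≈-trans (g-off u u≢v) (f≈f' u))) ,
    NewLabel-local {l} (λ u _ → f≈f' u) (f≈f' (site l))
      (NewLabel-resp {l} (g≈g' (site l)) new-label)

  act-functional : ∀ l → Functional (act l)
  act-functional l (g-off , g-rule) (h-off , h-rule) u with u ≟ site l
  ... | yes refl = NewLabel-functional {l} g-rule h-rule
  ... | no  u≢v  = ≈-trans (g-off u u≢v) (≈-sym (h-off u u≢v))

  act-commute : ∀ a b → Incomparable (site a) (site b) → (act a ∘P act b) ⇒ (act b ∘P act a)
  act-commute a b (x≰y , y≰x) {f} {h} (g , (g-off , g-rule) , (h-off , h-rule)) =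
    k , (k-off , k-rule) , (h-off' , h-rule')
    where
    x = site a
    y = site b
    -- Applying a to f already gives the final label at x: f and g differ only at y,
    -- which is not near x.
    k : Labeling
    k = updateAt f x (λ _ → h x)
    kx≈hx : k x ≈ h x
    kx≈hx = reflexive (updateAt-updates x f)
    k-off : ∀ u → u ≢ x → k u ≈ f u
    k-off u u≢x = reflexive (updateAt-minimal u x f u≢x)
    y≢x : y ≢ x
    y≢x refl = x≰y ≤-refl
    near-x⇒≢y : ∀ {u} → u < x ⊎ x < u → u ≢ y
    near-x⇒≢y (inj₁ (u≤x , _)) refl = y≰x u≤x
    near-x⇒≢y (inj₂ (x≤u , _)) refl = x≰y x≤u
    near-y⇒≢x : ∀ {u} → u < y ⊎ y < u → u ≢ x
    near-y⇒≢x (inj₁ (u≤y , _)) refl = x≰y u≤y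
    near-y⇒≢x (inj₂ (y≤u , _)) refl = y≰x y≤u
    k-rule : NewLabel a f (k x)
    k-rule = NewLabel-resp {a} (≈-sym kx≈hx)
      (NewLabel-local {a} (λ u u-near → g-off u (near-x⇒≢y u-near)) (g-off x (≡.≢-sym y≢x))
         h-rule)
    h-off' : ∀ u → u ≢ y → h u ≈ k u
    h-off' u u≢y with u ≟ x
    ... | yes refl = ≈-sym kx≈hx
    ... | no  u≢x  = ≈-trans (h-off u u≢x) (≈-trans (g-off u u≢y) (≈-sym (k-off u u≢x)))
    h-rule' : NewLabel b k (h y)
    h-rule' = NewLabel-resp {b} (≈-sym (h-off y y≢x))
      (NewLabel-local {b} (λ u u-near → ≈-sym (k-off u (near-y⇒≢x u-near))) (≈-sym (k-off y y≢x))
         g-rule)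

  elggot-undoes-toggle : ∀ {v f g h} → act (toggle at v) f g → act (elggot at v) g h → f ≈L h
  elggot-undoes-toggle {v} {f} {g} {h}
    (g-off , a , fv⁻¹≡a , b , par , gv≈) (h-off , a' , gv⁻¹≡a' , b' , par' , hv≈) u with u ≟ v
  ... | no u≢v   = ≈-sym (≈-trans (h-off u u≢v) (g-off u u≢v))
  ... | yes refl = ≈-sym (begin
    h v                     ≈⟨ hv≈ ⟩
    (b' * a') * lowSum g v  ≈⟨ formula-cong elggot (lowSum-cong near) ≈-refl
                                 (ParSum-cong (upLabels-cong near) par' par) ⟩
    (b * a') * lowSum f v   ≈⟨ cancel-sandwich (proj₂ fv⁻¹≡a) (proj₂ (proj₂ (proj₂ par)))
                                 (proj₂ (inverse-resp gv≈ ≈-refl gv⁻¹≡a')) ⟩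
    f v                     ∎)
    where
    near : AgreeNear v g f
    near w (inj₁ (_ , w≢v)) = g-off w w≢v
    near w (inj₂ (_ , v≢w)) = g-off w (≡.≢-sym v≢w)

  -- Words as partial maps

  ⟦_⟧ : Word → PMap
  ⟦ [] ⟧    = idP
  ⟦ a ∷ u ⟧ = act a ∘P ⟦ u ⟧

  ⟦⟧-congruent : ∀ u → Congruent ⟦ u ⟧
  ⟦⟧-congruent []      f≈f' g≈g' (lift f≈g) =
    lift λ x → ≈-trans (≈-sym (f≈f' x)) (≈-trans (f≈g x) (g≈g' x))
  ⟦⟧-congruent (a ∷ u) f≈f' g≈g' (k , r , s) =
    k , ⟦⟧-congruent u f≈f' ≈L-refl r , act-congruent a ≈L-refl g≈g' s

  ⟦⟧-functional : ∀ u → Functional ⟦ u ⟧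
  ⟦⟧-functional []      (lift f≈g) (lift f≈h) x = ≈-trans (≈-sym (f≈g x)) (f≈h x)
  ⟦⟧-functional (a ∷ u) (k , r , s) (k' , r' , s') =
    act-functional a s (act-congruent a (⟦⟧-functional u r' r) ≈L-refl s')

  ⟦⟧-++ : ∀ u v → (⟦ u ⟧ ∘P ⟦ v ⟧) ⇒ ⟦ u ++ v ⟧
  ⟦⟧-++ []      v (g , r , lift g≈h)    = ⟦⟧-congruent v ≈L-refl g≈h r
  ⟦⟧-++ (a ∷ u) v (g , r , (k , s , t)) = k , ⟦⟧-++ u v (g , r , s) , t

  Commute-sound : ∀ {u v} → Commute u v → ⟦ u ⟧ ⇒ ⟦ v ⟧
  Commute-sound (here {a} {b} a#b) (g , (k , r , b-kg) , a-gh) =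
    let g' , a-kg' , b-g'h = act-commute a b a#b (g , b-kg , a-gh) in g' , (k , r , a-kg') , b-g'h
  Commute-sound (there c) (g , r , s) = g , Commute-sound c r , s

  Reduce-sound : ∀ {u v} → Reduce u v → ⟦ u ⟧ ⇒ ⟦ v ⟧
  Reduce-sound (commute c)                          = Commute-sound c
  Reduce-sound (cancel {s = s}) (g , (k , r , t) , e) =
    ⟦⟧-congruent s ≈L-refl (elggot-undoes-toggle t e) r
  Reduce-sound (there red) (g , r , s)              = g , Reduce-sound red r , s

  ⇝-sound : ∀ {u v} → u ⇝ v → ⟦ u ⟧ ⇒ ⟦ v ⟧
  ⇝-sound ε            r = r
  ⇝-sound (red ◅ reds) r = ⇝-sound reds (Reduce-sound red r)

  Tprod⇒⟦⟪⟫⟧ : ∀ xs → Tprod xs ⇒ ⟦ ⟪ xs ⟫ ⟧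
  Tprod⇒⟦⟪⟫⟧ []       r           = r
  Tprod⇒⟦⟪⟫⟧ (x ∷ xs) (g , r , t) = g , Tprod⇒⟦⟪⟫⟧ xs r , t

  Eprod⇒⟦⟪⟫⁻¹⟧ : ∀ xs → Eprod xs ⇒ ⟦ ⟪ xs ⟫ ⁻¹ ⟧
  Eprod⇒⟦⟪⟫⁻¹⟧ []       r           = r
  Eprod⇒⟦⟪⟫⁻¹⟧ (x ∷ xs) (g , e , r) =
    ⟦⟧-++ (⟪ xs ⟫ ⁻¹) [ elggot at x ] (g , (_ , lift ≈L-refl , e) , Eprod⇒⟦⟪⟫⁻¹⟧ xs r)

  conjugate⇒ : ∀ xs {R u} → R ⇒ ⟦ u ⟧ →
               ((Tprod xs ∘P R) ∘P Eprod xs) ⇒ ⟦ ⟪ xs ⟫ ++ u ++ ⟪ xs ⟫ ⁻¹ ⟧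
  conjugate⇒ xs {u = u} R⇒u (g , e , k , r , t) =
    ⟦⟧-++ ⟪ xs ⟫ (u ++ _)
      (k , ⟦⟧-++ u (⟪ xs ⟫ ⁻¹) (g , Eprod⇒⟦⟪⟫⁻¹⟧ xs e , R⇒u r) , Tprod⇒⟦⟪⟫⟧ xs t)

  τ*prod⇒ : ∀ ws Ls → AllPairs Incomparable ws → ∀ {M} → IsLinearExtension (Below ws) M →
            τ*prod ws Ls ⇒ ⟦ ⟪ M ⟫ ++ ⟪ ws ⟫ ++ ⟪ M ⟫ ⁻¹ ⟧
  τ*prod⇒ [] [] [] {[]}    _     r = r
  τ*prod⇒ [] [] [] {_ ∷ _} M-ext _ =
    ⊥-elim (¬Any[] (proj₁ (proj₂ (IsLinearExtension.sound M-ext (here refl)))))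
  τ*prod⇒ (w ∷ ws) ((L , L-ext) ∷ Ls) (w#ws ∷ ws-incomparable) {M} M-ext (g , r , t) =
    ⇝-sound (conjugates-merge w#ws (isLinearExtension L-ext) M'-ext M-ext)
      (⟦⟧-++ (⟪ L ⟫ ++ toggle at w ∷ ⟪ L ⟫ ⁻¹) _
        (g , τ*prod⇒ ws Ls ws-incomparable M'-ext r , conjugate⇒ L (λ t → _ , lift ≈L-refl , t) t))
    where
    M'-ext : IsLinearExtension (Below ws) (filter (below? ws) M)
    M'-ext = IsLinearExtension-resp (proj₂ , λ z<ws → Below-++⁺ʳ [ w ] z<ws , z<ws)
               (filter-isLinearExtension (below? ws) M-ext)

open import Data.Nat using (ℕ; _≤_)

lemma5p24 : ∀ {c ℓ k} (P : FinPoset) (S : SkewField c ℓ)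
    → InfiniteSubfield S k
    → (C : SkewField.Carrier S) → IsCentral S C
    → (vs : List (FinPoset.El P)) → AllPairs (FinPoset.Incomparable P) vs
    → (i : ℕ) → 1 ≤ i → i ≤ length vs
    → (Ls : All (λ v → FinPoset.LinExt P (FinPoset.Below P (v ∷ []))) (take i vs))
    → (M : FinPoset.LinExt P (FinPoset.Below P (take i vs)))
    → Toggles._≐_ P S C
        (Toggles.τ*prod P S C (take i vs) Ls)
        (Toggles._∘P_ P S C
          (Toggles._∘P_ P S C (Toggles.η P S C M) (Toggles.Tprod P S C (take i vs)))
          (Toggles.η⁻¹ P S C M))
lemma5p24 P S _ C _ vs vs-incomparable i _ _ Ls (M , M-ext) _ _ _ lhs rhs =
  ⟦⟧-functional (⟪ M ⟫ ++ ⟪ ws ⟫ ++ ⟪ M ⟫ ⁻¹)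
    (τ*prod⇒ ws Ls (AllPairs.take⁺ i vs-incomparable) (isLinearExtension M-ext) lhs)
    (conjugate⇒ M (Tprod⇒⟦⟪⟫⟧ ws) rhs)
  where
  open Words P
  open Semantics P S C
  ws = take i vs
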